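{- Let $f(x)$ be a polynomial with nonnegative integer coefficients and let $b$ be an integer with $b\ge 10$. Then $f(10)_{b}\ge f(b)$.
   Context: For a nonnegative integer $N$ with ordinary decimal expansion $N=\sum_{i=0}^{m} d_i 10^i$, $d_i\in\{0,1,\dots,9\}$, and a real number $b>1$, define $N_b:=\sum_{i=0}^{m} d_i b^i$, i.e. the decimal digit string of $N$ interpreted in base $b$. Thus $f(10)_b$ means: compute the integer $f(10)$, write it in decimal, and reinterpret that digit string in base $b$. -}

module Defs where

open import Data.Nat using (ℕ; zero; suc; _+_; _*_)
open import Data.List using (List; []; _∷_)
open import Data.Product using (proj₁)
open import Data.Fin using (toℕ)
open import Data.Digit using (Expansion; toDigits)

-- A polynomial with nonnegative integer coefficients, given by its
-- coefficient list [a₀, a₁, …, aₙ] (constant term first).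
Poly : Set
Poly = List ℕ

eval : Poly → ℕ → ℕ
eval []       x = 0
eval (a ∷ as) x = a + x * eval as x

evalDigits : Expansion 10 → ℕ → ℕ
evalDigits []       b = 0
evalDigits (d ∷ ds) b = toℕ d + b * evalDigits ds b

-- N_b : the decimal digit string of N reinterpreted in base b.
reinterpret : ℕ → ℕ → ℕ
reinterpret N b = evalDigits (proj₁ (toDigits 10 N)) b

{-# OPTIONS --safe #-}
module Submission where

open import Defs
open import Data.Nat using (ℕ; zero; suc; _+_; _*_; _≤_; _<_; z≤n; s≤s)
open import Data.Nat.Properties
open import Data.Nat.DivMod using (_%_; m<n⇒m%n≡m; [m+kn]%n≡m%n)
open import Data.List using ([]; _∷_)
open import Data.Product using (_×_; _,_; proj₁; proj₂)
open import Data.Fin using (Fin; zero; toℕ; fromℕ<)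
open import Data.Fin.Properties using (toℕ<n; toℕ-fromℕ<)
open import Data.Digit using (Expansion; toDigits; fromDigits)
open import Relation.Binary.PropositionalEquality
open import Relation.Nullary using (yes; no)
open import Function using (_∘′_)

-- By Horner's rule it suffices that N ↦ N_b turns 10N + a into at least bN_b + a.
-- Appending a digit d sends N_b to bN_b + d, and incrementing N raises N_b by at
-- least 1: a carry turns a 9 into 0 and adds 1 one place up, worth b ≥ 10.

digit-unique : ∀ {n} (d e : Fin (suc n)) {x y : ℕ} →
               toℕ d + x * suc n ≡ toℕ e + y * suc n → toℕ d ≡ toℕ e × x ≡ y
digit-unique {n} d e {x} {y} eq = d≡e , x≡y
  where
  open ≡-Reasoning
  d≡e : toℕ d ≡ toℕ e
  d≡e = begin
    toℕ d                           ≡⟨ m<n⇒m%n≡m (toℕ<n d) ⟨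
    toℕ d % suc n                   ≡⟨ [m+kn]%n≡m%n (toℕ d) x (suc n) ⟨
    (toℕ d + x * suc n) % suc n     ≡⟨ cong (_% suc n) eq ⟩
    (toℕ e + y * suc n) % suc n     ≡⟨ [m+kn]%n≡m%n (toℕ e) y (suc n) ⟩
    toℕ e % suc n                   ≡⟨ m<n⇒m%n≡m (toℕ<n e) ⟩
    toℕ e                           ∎
  x≡y : x ≡ y
  x≡y = *-cancelʳ-≡ x y (suc n)
          (+-cancelˡ-≡ (toℕ e) _ _ (subst (λ u → u + x * suc n ≡ _) d≡e eq))

module _ (b : ℕ) where

  -- toDigits is defined by well-founded recursion and does not compute, so
  -- reinterpret is pinned down by showing that evalDigits only depends on the
  -- number an expansion denotes (expansions agree up to trailing zeros).
  evalDigits-zero : (es : Expansion 10) → 0 ≡ fromDigits es → 0 ≡ evalDigits es b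
  evalDigits-zero []       _  = refl
  evalDigits-zero (e ∷ es) eq =
    let 0≡e , 0≡es = digit-unique zero e {x = 0} eq
    in trans (sym (*-zeroʳ b)) (cong₂ (λ u v → u + b * v) 0≡e (evalDigits-zero es 0≡es))

  evalDigits-cong : (ds es : Expansion 10) →
                    fromDigits ds ≡ fromDigits es → evalDigits ds b ≡ evalDigits es b
  evalDigits-cong []       es       eq = evalDigits-zero es eq
  evalDigits-cong (d ∷ ds) []       eq = sym (evalDigits-zero (d ∷ ds) (sym eq))
  evalDigits-cong (d ∷ ds) (e ∷ es) eq =
    let d≡e , ds≡es = digit-unique d e eq
    in cong₂ (λ u v → u + b * v) d≡e (evalDigits-cong ds es ds≡es)

  reinterpret-fromDigits : (ds : Expansion 10) → reinterpret (fromDigits ds) b ≡ evalDigits ds b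
  reinterpret-fromDigits ds = evalDigits-cong (proj₁ canonical) ds (proj₂ canonical)
    where canonical = toDigits 10 (fromDigits ds)

  reinterpret-zero : reinterpret 0 b ≡ 0
  reinterpret-zero = reinterpret-fromDigits []

  reinterpret-digit : ∀ d M → d < 10 → reinterpret (d + M * 10) b ≡ d + b * reinterpret M b
  reinterpret-digit d M d<10 = begin
    reinterpret (d + M * 10) b                  ≡⟨ cong₂ (λ u v → reinterpret (u + v * 10) b)
                                                         (toℕ-fromℕ< d<10) (proj₂ (toDigits 10 M)) ⟨
    reinterpret (fromDigits (digit ∷ ds)) b     ≡⟨ reinterpret-fromDigits (digit ∷ ds) ⟩
    toℕ digit + b * evalDigits ds b             ≡⟨ cong (_+ b * evalDigits ds b) (toℕ-fromℕ< d<10) ⟩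
    d + b * reinterpret M b                     ∎
    where
    open ≡-Reasoning
    digit = fromℕ< d<10
    ds = proj₁ (toDigits 10 M)

module _ (b : ℕ) (10≤b : 10 ≤ b) where

  private
    R : ℕ → ℕ
    R N = reinterpret N b

  reinterpret-suc-fromDigits : (ds : Expansion 10) → suc (R (fromDigits ds)) ≤ R (suc (fromDigits ds))
  reinterpret-suc-fromDigits [] = begin
    suc (R 0)       ≡⟨ cong suc (reinterpret-zero b) ⟩
    1               ≤⟨ m≤m+n 1 (b * R 0) ⟩
    1 + b * R 0     ≡⟨ reinterpret-digit b 1 0 (s≤s (s≤s z≤n)) ⟨
    R 1             ∎
    where open ≤-Reasoning
  reinterpret-suc-fromDigits (d ∷ ds) = carry (toℕ d) (toℕ<n d)
    where
    M = fromDigits ds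
    carry : ∀ k → k < 10 → suc (R (k + M * 10)) ≤ R (suc k + M * 10)
    carry k k<10 with k ≟ 9
    ... | yes refl = begin
      suc (R (9 + M * 10))   ≡⟨ cong suc (reinterpret-digit b 9 M k<10) ⟩
      10 + b * R M           ≤⟨ +-monoˡ-≤ (b * R M) 10≤b ⟩
      b + b * R M            ≡⟨ *-suc b (R M) ⟨
      b * suc (R M)          ≤⟨ *-monoʳ-≤ b (reinterpret-suc-fromDigits ds) ⟩
      b * R (suc M)          ≡⟨ reinterpret-digit b 0 (suc M) (s≤s z≤n) ⟨
      R (suc M * 10)         ∎
      where open ≤-Reasoning
    ... | no k≢9 = ≤-reflexive (begin
      suc (R (k + M * 10))   ≡⟨ cong suc (reinterpret-digit b k M k<10) ⟩
      suc k + b * R M        ≡⟨ reinterpret-digit b (suc k) M (≤∧≢⇒< k<10 (k≢9 ∘′ suc-injective)) ⟨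
      R (suc k + M * 10)     ∎)
      where open ≡-Reasoning

  reinterpret-suc : ∀ N → suc (R N) ≤ R (suc N)
  reinterpret-suc N = subst (λ n → suc (R n) ≤ R (suc n)) (proj₂ (toDigits 10 N))
                            (reinterpret-suc-fromDigits (proj₁ (toDigits 10 N)))

  reinterpret-+ : ∀ a N → a + R N ≤ R (a + N)
  reinterpret-+ zero    N = ≤-refl
  reinterpret-+ (suc a) N = ≤-trans (s≤s (reinterpret-+ a N)) (reinterpret-suc (a + N))

corollary1 : (f : Poly) (b : ℕ) → 10 ≤ b → eval f b ≤ reinterpret (eval f 10) b
corollary1 []      b 10≤b = z≤n
corollary1 (a ∷ f) b 10≤b = begin
  a + b * eval f b            ≤⟨ +-monoʳ-≤ a (*-monoʳ-≤ b (corollary1 f b 10≤b)) ⟩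
  a + b * R (eval f 10)       ≡⟨ cong (a +_) (reinterpret-digit b 0 (eval f 10) (s≤s z≤n)) ⟨
  a + R (eval f 10 * 10)      ≤⟨ reinterpret-+ b 10≤b a (eval f 10 * 10) ⟩
  R (a + eval f 10 * 10)      ≡⟨ cong (λ m → R (a + m)) (*-comm (eval f 10) 10) ⟩
  R (a + 10 * eval f 10)      ∎
  where
  open ≤-Reasoning
  R : ℕ → ℕ
  R N = reinterpret N b
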